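{- Let $\alpha>0$ be an ordinal and $S\subseteq\mathbb{N}^\mathbb{N}$. If $S$ is guessable with $<\alpha+1$ mind changes, then $S\in D_\alpha$ or $\mathbb{N}^\mathbb{N}\setminus S\in D_\alpha$.
   Context: $\mathbb{N}^\mathbb{N}$ has the Baire space topology. $\mathbb{N}^{<\mathbb{N}}$ is the set of finite sequences; $f\upharpoonright n$ is the length-$n$ initial segment of $f$; $\chi_S$ is the characteristic function of $S$. $G:\mathbb{N}^{<\mathbb{N}}\to\{0,1\}$ is an $S$-guesser if $\lim_nG(f\upharpoonright n)=\chi_S(f)$ for all $f$. For an ordinal $\gamma$, $S$ is guessable with $<\gamma$ mind changes if there are an $S$-guesser $G$ and $H:\mathbb{N}^{<\mathbb{N}}\to\gamma$ such that for all $f,n$: $H(f\upharpoonright(n+1))\le H(f\upharpoonright n)$, and if $G(f\upharpoonright(n+1))\ne G(f\upharpoonright n)$ then $H(f\upharpoonright(n+1))<H(f\upharpoonright n)$. The parity of an ordinal $\eta=\lambda+n$ ($\lambda$ zero or limit, $n\in\mathbb{N}$) is $n\bmod2$. For $\theta\ge1$ and increasing $(A_\eta)_{\eta<\theta}$ of subsets of $\mathbb{N}^\mathbb{N}$, $x\in D_\theta((A_\eta)_{\eta<\theta})$ iff $x\in\bigcup_{\eta<\theta}A_\eta$ and the least $\eta$ with $x\in A_\eta$ has parity opposite to that of $\theta$; $D_\theta$ is the set of all such $D_\theta((A_\eta)_{\eta<\theta})$ with every $A_\eta$ open. -}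

module Defs where

open import Data.Nat using (ℕ; zero; suc; _≤_)
open import Data.Bool using (Bool; true; false; not)
open import Data.List using (List; []; _∷_)
open import Data.Product using (Σ; ∃; _×_; _,_)
open import Data.Sum using (_⊎_)
open import Data.Empty using (⊥)
open import Relation.Nullary using (¬_)
open import Relation.Binary.PropositionalEquality using (_≡_)
open import Relation.Binary.Definitions using (Transitive; Trichotomous)
open import Induction.WellFounded using (WellFounded)

Baire : Set
Baire = ℕ → ℕ

Seq : Set
Seq = List ℕ

_↾_ : Baire → ℕ → Seq
f ↾ zero = []
f ↾ suc n = f 0 ∷ ((λ i → f (suc i)) ↾ n)

Subset : Set₁
Subset = Baire → Set

∁ : Subset → Subset
∁ S f = ¬ S f

IsOpen : Subset → Set
IsOpen A = ∀ f → A f → ∃ λ n → ∀ g → g ↾ n ≡ f ↾ n → A g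

-- A well-ordered set; ordinals are represented as elements of such a set
-- (every ordinal α is an element of the well-order α+1).
record WellOrder : Set₁ where
  field
    Carrier : Set
    _≺_ : Carrier → Carrier → Set
    ≺-trans : Transitive _≺_
    ≺-tri : Trichotomous _≡_ _≺_
    ≺-wf : WellFounded _≺_

module WO (W : WellOrder) where
  open WellOrder W public

  _≼_ : Carrier → Carrier → Set
  x ≼ y = x ≺ y ⊎ x ≡ y

  IsSuccOf : Carrier → Carrier → Set
  IsSuccOf ζ η = ζ ≺ η × (∀ x → ζ ≺ x → η ≼ x)

  IsSucc : Carrier → Set
  IsSucc η = ∃ λ ζ → IsSuccOf ζ η

  -- parity of η = λ + n (λ zero or limit) is n mod 2 (false = even, true = odd)
  data Parity : Carrier → Bool → Set where
    par-lim : ∀ {η} → ¬ IsSucc η → Parity η false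
    par-suc : ∀ {ζ η b} → IsSuccOf ζ η → Parity ζ b → Parity η (not b)

  OppositeParity : Carrier → Carrier → Set
  OppositeParity η θ = ∃ λ b → Parity η b × Parity θ (not b)

  EventuallyEq : (ℕ → Bool) → Bool → Set
  EventuallyEq s b = ∃ λ N → ∀ n → N ≤ n → s n ≡ b

  IsGuesser : Subset → (Seq → Bool) → Set
  IsGuesser S G = ∀ f → (S f → EventuallyEq (λ n → G (f ↾ n)) true)
                      × (¬ S f → EventuallyEq (λ n → G (f ↾ n)) false)

  -- S guessable with < γ mind changes, where γ = α+1, i.e. H takes values ≼ α
  GuessableBelowSucc : Carrier → Subset → Set
  GuessableBelowSucc α S =
    Σ (Seq → Bool) λ G → Σ (Seq → Carrier) λ H →
      IsGuesser S G
      × (∀ s → H s ≼ α)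
      × (∀ f n → H (f ↾ suc n) ≼ H (f ↾ n))
      × (∀ f n → ¬ G (f ↾ suc n) ≡ G (f ↾ n) → H (f ↾ suc n) ≺ H (f ↾ n))

  InD : Carrier → (Carrier → Subset) → Baire → Set
  InD θ A x = ∃ λ η → η ≺ θ × A η x × (∀ ζ → ζ ≺ η → ¬ A ζ x)
                      × OppositeParity η θ

  -- S ∈ D_θ (A is only used on indices η ≺ θ)
  InDClass : Carrier → Subset → Set₁
  InDClass θ S = Σ (Carrier → Subset) λ A →
      (∀ η → η ≺ θ → IsOpen (A η))
      × (∀ η ζ → η ≼ ζ → ζ ≺ θ → ∀ x → A η x → A ζ x)
      × (∀ x → (S x → InD θ A x) × (InD θ A x → S x))

-- Replace the mind-change counter H along f by a corrected counter r that starts at α,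
-- never increases, stays above H, and moves exactly when the guess changes, each time
-- to an ordinal of the opposite parity.  Such a move is always possible below r when
-- H has dropped below r: if r is a successor take its predecessor, otherwise take H
-- or the successor of H, whichever has the right parity.  The parity of r then records
-- whether the current guess agrees with the initial guess G [].  The sets
-- A η = {f | r eventually ≤ η} are open and increasing, and the least η with f ∈ A η is
-- the eventual value of r along f; it has parity opposite to α exactly when the limit
-- guess differs from G [].  So the set of f whose limit guess differs from G [], which
-- is S or its complement, lies in D_α.
module Submission where

open import Defs
open import Data.Product using (∃)
open import Data.Sum using (_⊎_)
open import Axiom.ExcludedMiddle using (ExcludedMiddle)
open import Level using (0ℓ)

open import Axiom.DoubleNegationElimination using (em⇒dne)
open import Data.Bool using (Bool; true; false; not; _xor_)
open import Data.Bool.Properties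
  using (_≟_; not-involutive; ¬-not; not-¬; not-distribˡ-xor; not-distribʳ-xor)
open import Data.Empty using (⊥-elim)
open import Data.List using ([]; _∷_; take)
open import Data.Nat using (ℕ; zero; suc; _≤_; _≤′_; _⊔_; z≤n; s≤s; ≤′-refl; ≤′-step)
open import Data.Nat.Properties using (≤-refl; ≤⇒≤′; m≤n⇒m≤1+n; n≤1+n; m≤m⊔n; m≤n⊔m)
open import Data.Product using (Σ; _×_; _,_; proj₁; proj₂)
open import Data.Sum using (inj₁; inj₂)
open import Function using (_∘_)
open import Induction.WellFounded using (Acc; acc)
open import Relation.Binary.Definitions using (tri<; tri≈; tri>)
open import Relation.Binary.PropositionalEquality
  using (_≡_; _≢_; refl; sym; trans; cong; cong₂; subst; module ≡-Reasoning)
open import Relation.Nullary using (¬_; yes; no)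

≡-not-sym : ∀ {x y} → x ≡ not y → y ≡ not x
≡-not-sym {y = y} refl = sym (not-involutive y)

xor-cancelʳ : ∀ {x y} z → x xor z ≡ y xor z → x ≡ y
xor-cancelʳ {true}  {true}  _ _ = refl
xor-cancelʳ {false} {false} _ _ = refl
xor-cancelʳ {true}  {false} z e = ⊥-elim (not-¬ refl (sym e))
xor-cancelʳ {false} {true}  z e = ⊥-elim (not-¬ refl e)

not-xor-not : ∀ x y → not x xor not y ≡ x xor y
not-xor-not true  y = refl
not-xor-not false y = not-involutive y

take-↾ : ∀ (f : Baire) {i n} → i ≤ n → take i (f ↾ n) ≡ f ↾ i
take-↾ f z≤n       = refl
take-↾ f (s≤s i≤n) = cong (f 0 ∷_) (take-↾ (f ∘ suc) i≤n)

↾-agree-below : ∀ {f g : Baire} {i n} → g ↾ n ≡ f ↾ n → i ≤ n → g ↾ i ≡ f ↾ i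
↾-agree-below {f} {g} {i} {n} e i≤n = begin
  g ↾ i            ≡⟨ sym (take-↾ g i≤n) ⟩
  take i (g ↾ n)   ≡⟨ cong (take i) e ⟩
  take i (f ↾ n)   ≡⟨ take-↾ f i≤n ⟩
  f ↾ i            ∎
  where open ≡-Reasoning

module WellOrderProperties (W : WellOrder) where
  open WO W

  ≺-irrefl : ∀ {x} → ¬ x ≺ x
  ≺-irrefl {x} x≺x with ≺-tri x x
  ... | tri< _ x≢x _ = x≢x refl
  ... | tri≈ x⊀x _ _ = x⊀x x≺x
  ... | tri> x⊀x _ _ = x⊀x x≺x

  ≼-trans : ∀ {x y z} → x ≼ y → y ≼ z → x ≼ z
  ≼-trans (inj₁ x≺y) (inj₁ y≺z) = inj₁ (≺-trans x≺y y≺z)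
  ≼-trans (inj₁ x≺y) (inj₂ refl) = inj₁ x≺y
  ≼-trans (inj₂ refl) y≼z        = y≼z

  ≺-≼-trans : ∀ {x y z} → x ≺ y → y ≼ z → x ≺ z
  ≺-≼-trans x≺y (inj₁ y≺z) = ≺-trans x≺y y≺z
  ≺-≼-trans x≺y (inj₂ refl) = x≺y

  ≼-≺-trans : ∀ {x y z} → x ≼ y → y ≺ z → x ≺ z
  ≼-≺-trans (inj₁ x≺y) y≺z = ≺-trans x≺y y≺z
  ≼-≺-trans (inj₂ refl) y≺z = y≺z

  ≮⇒≽ : ∀ {x y} → ¬ y ≺ x → x ≼ y
  ≮⇒≽ {x} {y} y⊀x with ≺-tri x y
  ... | tri< x≺y _ _ = inj₁ x≺y
  ... | tri≈ _ x≡y _ = inj₂ x≡y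
  ... | tri> _ _ y≺x = ⊥-elim (y⊀x y≺x)

  ≼∧≢⇒≺ : ∀ {x y} → x ≼ y → x ≢ y → x ≺ y
  ≼∧≢⇒≺ (inj₁ x≺y) _ = x≺y
  ≼∧≢⇒≺ (inj₂ x≡y) x≢y = ⊥-elim (x≢y x≡y)

  antitone : (s : ℕ → Carrier) → (∀ n → s (suc n) ≼ s n) → ∀ {m n} → m ≤ n → s n ≼ s m
  antitone s step = go ∘ ≤⇒≤′
    where
      go : ∀ {m n} → m ≤′ n → s n ≼ s m
      go ≤′-refl          = inj₂ refl
      go (≤′-step {n} m≤′n) = ≼-trans (step n) (go m≤′n)

  IsSuccOf-unique : ∀ {ζ ζ′ η} → IsSuccOf ζ η → IsSuccOf ζ′ η → ζ ≡ ζ′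
  IsSuccOf-unique {ζ} {ζ′} (ζ≺η , η-least) (ζ′≺η , η-least′) with ≺-tri ζ ζ′
  ... | tri< ζ≺ζ′ _ _ = ⊥-elim (≺-irrefl (≺-≼-trans ζ′≺η (η-least ζ′ ζ≺ζ′)))
  ... | tri≈ _ ζ≡ζ′ _ = ζ≡ζ′
  ... | tri> _ _ ζ′≺ζ = ⊥-elim (≺-irrefl (≺-≼-trans ζ≺η (η-least′ ζ ζ′≺ζ)))

  Parity-unique : ∀ {η b b′} → Parity η b → Parity η b′ → b ≡ b′
  Parity-unique (par-lim _)         (par-lim _)           = refl
  Parity-unique (par-lim ¬succ)     (par-suc succ _)      = ⊥-elim (¬succ (_ , succ))
  Parity-unique (par-suc succ _)    (par-lim ¬succ)       = ⊥-elim (¬succ (_ , succ))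
  Parity-unique (par-suc succ par) (par-suc succ′ par′) with IsSuccOf-unique succ succ′
  ... | refl = cong not (Parity-unique par par′)

module ClassicalWellOrder (em : ExcludedMiddle 0ℓ) (W : WellOrder) where
  open WO W
  open WellOrderProperties W

  minimal-witness : (P : Carrier → Set) → ∀ {x} → P x →
                    Σ Carrier λ m → P m × (∀ y → y ≺ m → ¬ P y)
  minimal-witness P {x} = go x (≺-wf x)
    where
      go : ∀ x → Acc _≺_ x → P x → Σ Carrier λ m → P m × (∀ y → y ≺ m → ¬ P y)
      go x (acc rs) px with em {Σ Carrier λ y → y ≺ x × P y}
      ... | yes (y , y≺x , py) = go y (rs y≺x) py
      ... | no ¬smaller        = x , px , λ y y≺x py → ¬smaller (y , y≺x , py)

  minimum-attained : (s : ℕ → Carrier) → ∃ λ N → ∀ n → s N ≼ s n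
  minimum-attained s with minimal-witness (λ x → ∃ λ n → s n ≡ x) (0 , refl)
  ... | _ , (N , refl) , minimal = N , λ n → ≮⇒≽ (λ sn≺sN → minimal (s n) sn≺sN (n , refl))

  antitone-minimum-beyond : (s : ℕ → Carrier) → (∀ n → s (suc n) ≼ s n) →
                            ∀ K → Σ ℕ λ M → K ≤ M × (∀ n → s M ≼ s n)
  antitone-minimum-beyond s step K with minimum-attained s
  ... | N , minimal = N ⊔ K , m≤n⊔m N K ,
                      λ n → ≼-trans (antitone s step (m≤m⊔n N K)) (minimal n)

  successor-below : ∀ {h r} → h ≺ r → Σ Carrier λ h⁺ → IsSuccOf h h⁺ × h⁺ ≼ r
  successor-below {h} {r} h≺r with minimal-witness (h ≺_) h≺r
  ... | h⁺ , h≺h⁺ , minimal = h⁺ , (h≺h⁺ , above) , above r h≺r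
    where
      above : ∀ x → h ≺ x → h⁺ ≼ x
      above x h≺x = ≮⇒≽ (λ x≺h⁺ → minimal x x≺h⁺ h≺x)

  parity-from : ∀ η → Acc _≺_ η → Σ Bool (Parity η)
  parity-from η (acc rs) with em {IsSucc η}
  ... | yes (ζ , succ) = let b , par = parity-from ζ (rs (proj₁ succ)) in not b , par-suc succ par
  ... | no ¬succ       = false , par-lim ¬succ

  parity : Carrier → Bool
  parity η = proj₁ (parity-from η (≺-wf η))

  parity-Parity : ∀ η → Parity η (parity η)
  parity-Parity η = proj₂ (parity-from η (≺-wf η))

  parity-succ : ∀ {ζ η} → IsSuccOf ζ η → parity η ≡ not (parity ζ)
  parity-succ {ζ} {η} succ = Parity-unique (parity-Parity η) (par-suc succ (parity-Parity ζ))

  OppositeParity⇒parity : ∀ {η θ} → OppositeParity η θ → parity η ≡ not (parity θ)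
  OppositeParity⇒parity {η} {θ} (b , par-η , par-θ) =
    trans (Parity-unique (parity-Parity η) par-η) (≡-not-sym (Parity-unique (parity-Parity θ) par-θ))

  parity⇒OppositeParity : ∀ {η θ} → parity η ≡ not (parity θ) → OppositeParity η θ
  parity⇒OppositeParity {η} {θ} e =
    parity η , parity-Parity η , subst (Parity θ) (≡-not-sym e) (parity-Parity θ)

  opposite-parity-below : ∀ {h r} → h ≺ r →
                          Σ Carrier λ ρ → h ≼ ρ × ρ ≺ r × parity ρ ≡ not (parity r)
  opposite-parity-below {h} {r} h≺r with em {IsSucc r}
  ... | yes (ζ , succ@(ζ≺r , r-least)) =
        ζ , ≮⇒≽ (λ ζ≺h → ≺-irrefl (≺-≼-trans h≺r (r-least h ζ≺h))) , ζ≺r ,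
        ≡-not-sym (parity-succ succ)
  ... | no ¬succ with parity h ≟ parity r
  ...   | no h≢r = h , inj₂ refl , h≺r , ¬-not h≢r
  ...   | yes h≡r with successor-below h≺r
  ...     | h⁺ , succ , h⁺≼r =
            h⁺ , inj₁ (proj₁ succ) ,
            ≼∧≢⇒≺ h⁺≼r (λ h⁺≡r → ¬succ (h , subst (IsSuccOf h) h⁺≡r succ)) ,
            trans (parity-succ succ) (cong not h≡r)

  module Correction (α : Carrier) where

    -- The fallback value r when h ⊀ r is never reached under the invariant h ≼ r.
    descend : Carrier → Carrier → Carrier
    descend r h with em {h ≺ r}
    ... | yes h≺r = proj₁ (opposite-parity-below h≺r)
    ... | no _    = r

    descend-spec : ∀ {r h} → h ≺ r →
                   h ≼ descend r h × descend r h ≺ r × parity (descend r h) ≡ not (parity r)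
    descend-spec {r} {h} h≺r with em {h ≺ r}
    ... | yes h≺r′ = proj₂ (opposite-parity-below h≺r′)
    ... | no h⊀r   = ⊥-elim (h⊀r h≺r)

    update : Bool → Bool → Carrier → Carrier → Carrier
    update g g′ r h with g′ ≟ g
    ... | yes _ = r
    ... | no _  = descend r h

    update-spec : ∀ {g g′ r h h₀} → h ≼ h₀ → h₀ ≼ r → (g′ ≢ g → h ≺ h₀) →
                  h ≼ update g g′ r h × update g g′ r h ≼ r ×
                  parity (update g g′ r h) xor g′ ≡ parity r xor g
    update-spec {g} {g′} {r} {h} h≼h₀ h₀≼r drop with g′ ≟ g
    ... | yes refl = ≼-trans h≼h₀ h₀≼r , inj₂ refl , refl
    ... | no g′≢g with descend-spec (≺-≼-trans (drop g′≢g) h₀≼r)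
    ...   | h≼ρ , ρ≺r , ρ-parity = h≼ρ , inj₁ ρ≺r , (begin
              parity (descend r h) xor g′  ≡⟨ cong₂ _xor_ ρ-parity (¬-not g′≢g) ⟩
              not (parity r) xor not g     ≡⟨ not-xor-not (parity r) g ⟩
              parity r xor g               ∎)
      where open ≡-Reasoning

    corrected : (ℕ → Bool) → (ℕ → Carrier) → ℕ → Carrier
    corrected g h zero    = α
    corrected g h (suc n) = update (g n) (g (suc n)) (corrected g h n) (h (suc n))

    corrected-local : ∀ {g g′ h h′} n → (∀ i → i ≤ n → g i ≡ g′ i) → (∀ i → i ≤ n → h i ≡ h′ i) →
                      corrected g h n ≡ corrected g′ h′ n
    corrected-local zero    _  _  = refl
    corrected-local (suc n) g≡ h≡
      rewrite corrected-local n (λ i → g≡ i ∘ m≤n⇒m≤1+n) (λ i → h≡ i ∘ m≤n⇒m≤1+n)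
            | g≡ n (n≤1+n n) | g≡ (suc n) ≤-refl | h≡ (suc n) ≤-refl = refl

    module Invariants (g : ℕ → Bool) (h : ℕ → Carrier) (h₀≼α : h 0 ≼ α)
                      (h-step : ∀ n → h (suc n) ≼ h n)
                      (h-drops : ∀ n → g (suc n) ≢ g n → h (suc n) ≺ h n) where

      h≼corrected : ∀ n → h n ≼ corrected g h n
      corrected-update : ∀ n →
        h (suc n) ≼ corrected g h (suc n) × corrected g h (suc n) ≼ corrected g h n ×
        parity (corrected g h (suc n)) xor g (suc n) ≡ parity (corrected g h n) xor g n

      h≼corrected zero    = h₀≼α
      h≼corrected (suc n) = proj₁ (corrected-update n)

      corrected-update n = update-spec (h-step n) (h≼corrected n) (h-drops n)

      corrected-step : ∀ n → corrected g h (suc n) ≼ corrected g h n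
      corrected-step n = proj₁ (proj₂ (corrected-update n))

      corrected≼α : ∀ n → corrected g h n ≼ α
      corrected≼α n = antitone (corrected g h) corrected-step {0} {n} z≤n

      corrected-parity-invariant : ∀ n → parity (corrected g h n) xor g n ≡ parity α xor g 0
      corrected-parity-invariant zero    = refl
      corrected-parity-invariant (suc n) =
        trans (proj₂ (proj₂ (corrected-update n))) (corrected-parity-invariant n)

    module Flipping (G : Seq → Bool) (H : Seq → Carrier) (H≼α : ∀ s → H s ≼ α)
                    (H-step : ∀ f n → H (f ↾ suc n) ≼ H (f ↾ n))
                    (H-drops : ∀ f n → ¬ G (f ↾ suc n) ≡ G (f ↾ n) → H (f ↾ suc n) ≺ H (f ↾ n)) where

      r : Baire → ℕ → Carrier
      r f = corrected (λ n → G (f ↾ n)) (λ n → H (f ↾ n))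

      module Along (f : Baire) =
        Invariants (λ n → G (f ↾ n)) (λ n → H (f ↾ n)) (H≼α []) (H-step f) (H-drops f)

      r-local : ∀ {f f′ n} → f′ ↾ n ≡ f ↾ n → r f′ n ≡ r f n
      r-local {n = n} e =
        corrected-local n (λ i → cong G ∘ ↾-agree-below e) (λ i → cong H ∘ ↾-agree-below e)

      Reached : Carrier → Subset
      Reached η f = ∃ λ n → r f n ≼ η

      Reached-open : ∀ η → IsOpen (Reached η)
      Reached-open η f (n , r≼η) = n , λ f′ f′↾n≡f↾n → n , subst (_≼ η) (sym (r-local f′↾n≡f↾n)) r≼η

      Reached-mono : ∀ {η ζ f} → η ≼ ζ → Reached η f → Reached ζ f
      Reached-mono η≼ζ (n , r≼η) = n , ≼-trans r≼η η≼ζ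

      eventual-minimum : ∀ {f b} → EventuallyEq (λ n → G (f ↾ n)) b →
                         Σ ℕ λ M → (∀ n → r f M ≼ r f n) × parity (r f M) xor b ≡ parity α xor G []
      eventual-minimum {f} {b} (K , G≡b) with antitone-minimum-beyond (r f) (Along.corrected-step f) K
      ... | M , K≤M , minimal =
            M , minimal , subst (λ c → parity (r f M) xor c ≡ parity α xor G [])
                                (G≡b M K≤M) (Along.corrected-parity-invariant f M)

      flipped⇒InD : ∀ {f b} → EventuallyEq (λ n → G (f ↾ n)) b → b ≢ G [] → InD α Reached f
      flipped⇒InD {f} {b} ev b≢g₀ with eventual-minimum ev
      ... | M , minimal , invariant =
            r f M , r≺α , (M , inj₂ refl) , unreached-below , parity⇒OppositeParity r-parity
        where
          open ≡-Reasoning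
          r-parity : parity (r f M) ≡ not (parity α)
          r-parity = xor-cancelʳ b (begin
            parity (r f M) xor b   ≡⟨ invariant ⟩
            parity α xor G []      ≡⟨ cong (parity α xor_) (¬-not (b≢g₀ ∘ sym)) ⟩
            parity α xor not b     ≡⟨ sym (not-distribʳ-xor (parity α) b) ⟩
            not (parity α xor b)   ≡⟨ not-distribˡ-xor (parity α) b ⟩
            not (parity α) xor b   ∎)
          r≺α : r f M ≺ α
          r≺α = ≼∧≢⇒≺ (Along.corrected≼α f M)
                      (λ r≡α → not-¬ refl (trans (cong parity (sym r≡α)) r-parity))
          unreached-below : ∀ ζ → ζ ≺ r f M → ¬ Reached ζ f
          unreached-below ζ ζ≺r (n , r≼ζ) = ≺-irrefl (≼-≺-trans (≼-trans (minimal n) r≼ζ) ζ≺r)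

      InD⇒flipped : ∀ {f b} → EventuallyEq (λ n → G (f ↾ n)) b → InD α Reached f → b ≢ G []
      InD⇒flipped {f} ev (η , _ , (n , r≼η) , unreached-below , opposite) b≡g₀
        with eventual-minimum ev
      ... | M , minimal , invariant = not-¬ refl (begin
            parity α         ≡⟨ sym (xor-cancelʳ (G []) (subst (λ c → parity (r f M) xor c ≡ _) b≡g₀ invariant)) ⟩
            parity (r f M)   ≡⟨ cong parity r≡η ⟩
            parity η         ≡⟨ OppositeParity⇒parity opposite ⟩
            not (parity α)   ∎)
        where
          open ≡-Reasoning
          r≡η : r f M ≡ η
          r≡η with ≼-trans (minimal n) r≼η
          ... | inj₁ r≺η = ⊥-elim (unreached-below (r f M) r≺η (M , inj₂ refl))
          ... | inj₂ r≡η = r≡η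

      flipped-InDClass : (T : Subset) (c : Bool) → G [] ≡ c →
                         (∀ f → T f → EventuallyEq (λ n → G (f ↾ n)) (not c)) →
                         (∀ f → ¬ T f → EventuallyEq (λ n → G (f ↾ n)) c) → InDClass α T
      flipped-InDClass T c refl flips stays =
        Reached , (λ η _ → Reached-open η) , (λ _ _ η≼ζ _ _ → Reached-mono η≼ζ) ,
        λ f → (λ Tf → flipped⇒InD (flips f Tf) (not-¬ refl ∘ sym)) ,
              (λ inD → em⇒dne em (λ ¬Tf → InD⇒flipped (stays f ¬Tf) inD refl))

corollary4p10 : ExcludedMiddle 0ℓ → (W : WellOrder) → let open WO W in
    (α : Carrier) → (∃ λ ζ → ζ ≺ α) → (S : Subset) →
    GuessableBelowSucc α S → InDClass α S ⊎ InDClass α (∁ S)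
corollary4p10 em W α _ S (G , H , guess , H≼α , H-step , H-drops) = by-initial-guess (G []) refl
  where
    open WO W
    open ClassicalWellOrder.Correction.Flipping em W α G H H≼α H-step H-drops

    by-initial-guess : ∀ c → G [] ≡ c → InDClass α S ⊎ InDClass α (∁ S)
    by-initial-guess false g₀ = inj₁ (flipped-InDClass S false g₀ (proj₁ ∘ guess) (proj₂ ∘ guess))
    by-initial-guess true  g₀ = inj₂ (flipped-InDClass (∁ S) true g₀ (proj₂ ∘ guess)
                                        (λ f ¬¬Sf → proj₁ (guess f) (em⇒dne em ¬¬Sf)))
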